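{- Let $m\ge1$ and $k\ge1$, and let $\{a_n\}_{n\ge0}$ be the $m$-gonal sequence. Then $a_{mk+1}=a_{mk}+a_{m(k-1)+1}$.
   Context: Bins of an increasing sequence $\{a_n\}_{n\ge0}$: $b_0=[a_0]$, $b_k=[a_{m(k-1)+1},\dots,a_{mk}]$ for $k\ge1$. A legal $m$-gonal decomposition of $z$ is $z=a_{\ell_t}+\cdots+a_{\ell_1}$ with $\ell_1<\cdots<\ell_t$ and no two summands in the same bin. The $m$-gonal sequence: each $a_i$ ($i\ge0$) is the smallest positive integer with no legal $m$-gonal decomposition using only $a_0,\dots,a_{i-1}$. -}

module Defs where

open import Data.Nat using (ℕ; zero; suc; _+_; _*_; _∸_; _≤_; _<_)
open import Data.List using (List; map)
open import Data.Nat.ListAction using (sum)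
open import Data.List.Relation.Unary.All using (All)
open import Data.List.Relation.Unary.AllPairs using (AllPairs)
open import Data.Product using (Σ; ∃; _×_)
open import Data.Sum using (_⊎_)
open import Relation.Nullary using (¬_)
open import Relation.Binary.PropositionalEquality using (_≡_)

-- Index i lies in bin k (for parameter m):
--   b_0 = [a_0],  b_k = [a_{m(k-1)+1}, ..., a_{mk}] for k ≥ 1.
InBin : ℕ → ℕ → ℕ → Set
InBin m k i = (k ≡ 0 × i ≡ 0) ⊎ (1 ≤ k × (m * (k ∸ 1) + 1 ≤ i × i ≤ m * k))

SameBin : ℕ → ℕ → ℕ → Set
SameBin m i j = ∃ λ k → InBin m k i × InBin m k j

LegalDecomp : ℕ → (ℕ → ℕ) → ℕ → ℕ → Set
LegalDecomp m a n z =
  Σ (List ℕ) λ ls →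
    AllPairs (λ i j → i < j × ¬ SameBin m i j) ls
    × All (λ i → i < n) ls
    × sum (map a ls) ≡ z

IsMGonal : ℕ → (ℕ → ℕ) → Set
IsMGonal m a = ∀ i →
  (0 < a i)
  × ¬ LegalDecomp m a i (a i)
  × (∀ z → 0 < z → z < a i → LegalDecomp m a i z)

module Submission where

-- Write M_k = a_0 + a_m + a_{2m} + ... + a_{mk} for the sum of the largest
-- element of each of the bins b_0, ..., b_k.  The theorem follows from
--
--     a_{mk+1} = M_k + 1        for every k ≥ 0,                        (*)
--
-- since then a_{m(k+1)+1} = M_k + a_{m(k+1)} + 1 = a_{m(k+1)} + a_{mk+1}.
-- By minimality, a_p ≤ B + 1 when every legal sum of a_0..a_{p-1} is ≤ B,
-- and a_p > B when every z ≤ B is such a legal sum.  So (*) splits into: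
--   * an upper bound: a legal sum of a_0..a_{mk} is at most M_k, because it
--     uses at most one index from each bin and a is increasing;
--   * completeness: every z ≤ M_k is a legal sum of a_0..a_{mk}.  This is
--     proved by induction on k, sweeping through the bin b_{k+1} one index
--     J at a time: a value z ≤ a_J + M_k that is not already covered is
--     a_J plus a legal sum of a_0..a_{mk}, and a_{J+1} ≤ a_J + M_k + 1
--     guarantees that no gap appears between consecutive steps.

open import Defs
open import Data.Nat using (ℕ; zero; suc; _+_; _*_; _∸_; _≤_; _<_; _≤′_; ≤′-reflexive; ≤′-step; z≤n; s≤s; _≤?_)
open import Data.Nat.Properties
open import Data.List using (List; []; _∷_; map; _++_; filter)
open import Data.List.Properties using (map-++; filter-accept; filter-reject)
open import Data.Nat.ListAction using (sum)
open import Data.Nat.ListAction.Properties using (sum-++)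
open import Data.List.Relation.Unary.All using (All; []; _∷_)
import Data.List.Relation.Unary.All as All
import Data.List.Relation.Unary.All.Properties as AllP
open import Data.List.Relation.Unary.AllPairs using (AllPairs; []; _∷_)
import Data.List.Relation.Unary.AllPairs.Properties as AllPairsP
open import Data.Product using (_×_; _,_; proj₁; proj₂)
open import Data.Sum using (inj₁; inj₂)
open import Relation.Nullary using (¬_; yes; no; contradiction)
open import Relation.Binary.PropositionalEquality using (_≡_; refl; sym; trans; cong; cong₂; subst; subst₂; module ≡-Reasoning)

sameBin-block : ∀ m k {i j} → m * k < i → i ≤ m * suc k → m * k < j → j ≤ m * suc k →
                SameBin m i j
sameBin-block m k mk<i i≤ mk<j j≤ =
  suc k , inj₂ (s≤s z≤n , start mk<i , i≤) , inj₂ (s≤s z≤n , start mk<j , j≤)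
  where
  start : ∀ {x} → m * k < x → m * k + 1 ≤ x
  start {x} = subst (_≤ x) (+-comm 1 (m * k))

apart-across : ∀ m k {i j} → i ≤ m * k → m * k < j → ¬ SameBin m i j
apart-across m k _ () (_ , _ , inj₁ (_ , refl))
apart-across m k i≤ mk<j (_ , inj₁ (refl , _) , inj₂ (() , _))
apart-across m k {i} i≤ mk<j (b , inj₂ (_ , bin-start≤i , _) , inj₂ (_ , _ , j≤bin-end)) =
  <-irrefl refl (<-≤-trans b-1<k k≤b-1)
  where
  b-1<k : b ∸ 1 < k
  b-1<k = *-cancelˡ-< m (b ∸ 1) k
            (≤-trans (subst (_≤ i) (+-comm (m * (b ∸ 1)) 1) bin-start≤i) i≤)
  k≤b-1 : k ≤ b ∸ 1
  k≤b-1 = ∸-monoˡ-≤ 1 (*-cancelˡ-< m k b (<-≤-trans mk<j j≤bin-end))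

module MGonal (n : ℕ) (a : ℕ → ℕ) (isM : IsMGonal (suc n) a) where

  m : ℕ
  m = suc n

  Apart : ℕ → ℕ → Set
  Apart i j = i < j × ¬ SameBin m i j

  Σa : List ℕ → ℕ
  Σa ls = sum (map a ls)

  Complete : ℕ → ℕ → Set
  Complete p B = ∀ z → z ≤ B → LegalDecomp m a p z

  Bounded : ℕ → ℕ → Set
  Bounded p B = ∀ z → LegalDecomp m a p z → z ≤ B

  widen : ∀ {p q z} → p ≤ q → LegalDecomp m a p z → LegalDecomp m a q z
  widen p≤q (ls , apart , below , sum≡) = ls , apart , All.map (λ i<p → ≤-trans i<p p≤q) below , sum≡

  emptyDecomp : ∀ {p} → LegalDecomp m a p 0
  emptyDecomp = [] , [] , [] , refl

  singletonDecomp : ∀ {p} j → j < p → LegalDecomp m a p (a j)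
  singletonDecomp j j<p = j ∷ [] , [] ∷ [] , j<p ∷ [] , +-identityʳ (a j)

  next-≤ : ∀ p B → Bounded p B → a p ≤ suc B
  next-≤ p B bounded with a p ≤? suc B
  ... | yes ≤B+1 = ≤B+1
  ... | no ≰B+1 = contradiction (bounded (suc B) B+1-decomp) 1+n≰n
    where
    B+1-decomp : LegalDecomp m a p (suc B)
    B+1-decomp = proj₂ (proj₂ (isM p)) (suc B) (s≤s z≤n) (≰⇒> ≰B+1)

  next-> : ∀ p B → Complete p B → B < a p
  next-> p B complete with a p ≤? B
  ... | yes ≤B = contradiction (complete (a p) ≤B) (proj₁ (proj₂ (isM p)))
  ... | no ≰B = ≰⇒> ≰B

  -- The sequence is strictly increasing: a_0..a_i represent all of [0, a_i]
  -- (values below a_i by minimality of a_i, and a_i itself as one term).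
  a-increasing : ∀ i → a i < a (suc i)
  a-increasing i = next-> (suc i) (a i) upToAᵢ
    where
    upToAᵢ : Complete (suc i) (a i)
    upToAᵢ zero _ = emptyDecomp
    upToAᵢ (suc z) z≤aᵢ with m≤n⇒m<n∨m≡n z≤aᵢ
    ... | inj₁ z<aᵢ = widen (n≤1+n i) (proj₂ (proj₂ (isM i)) (suc z) (s≤s z≤n) z<aᵢ)
    ... | inj₂ z+1≡aᵢ = subst (LegalDecomp m a (suc i)) (sym z+1≡aᵢ) (singletonDecomp i ≤-refl)

  a-mono : ∀ {i j} → i ≤ j → a i ≤ a j
  a-mono i≤j = a-mono′ (≤⇒≤′ i≤j)
    where
    a-mono′ : ∀ {i j} → i ≤′ j → a i ≤ a j
    a-mono′ (≤′-reflexive refl) = ≤-refl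
    a-mono′ (≤′-step i≤′j) = ≤-trans (a-mono′ i≤′j) (<⇒≤ (a-increasing _))

  -- Nothing is representable from the empty prefix, so a_0 = 1.
  a₀≡1 : a 0 ≡ 1
  a₀≡1 = ≤-antisym (next-≤ 0 0 nothingBelow0) (proj₁ (isM 0))
    where
    nothingBelow0 : Bounded 0 0
    nothingBelow0 _ ([] , _ , _ , refl) = z≤n
    nothingBelow0 _ (_ ∷ _ , _ , () ∷ _ , _)

  M : ℕ → ℕ
  M zero = a 0
  M (suc k) = M k + a (m * suc k)

  -- Upper bound.  In a legal sum whose indices are all ≤ j ≤ m(k+1), at most
  -- one index exceeds mk (all such indices share the bin b_{k+1}), so
  -- dropping it loses at most a_j.
  dropTop : ∀ k j → j ≤ m * suc k → ∀ ls → AllPairs Apart ls → All (_< suc j) ls →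
            Σa ls ≤ Σa (filter (_≤? m * k) ls) + a j
  dropTop k j j≤ [] _ _ = z≤n
  dropTop k j j≤ (x ∷ xs) (_ ∷ apart) (_ ∷ below) with x ≤? m * k
  ... | yes x≤mk = begin
    a x + Σa xs                               ≤⟨ +-monoʳ-≤ (a x) (dropTop k j j≤ xs apart below) ⟩
    a x + (Σa (filter (_≤? m * k) xs) + a j)  ≡⟨ +-assoc (a x) _ (a j) ⟨
    Σa (x ∷ filter (_≤? m * k) xs) + a j      ≡⟨ cong (λ l → Σa l + a j) (filter-accept (_≤? m * k) x≤mk) ⟨
    Σa (filter (_≤? m * k) (x ∷ xs)) + a j    ∎
    where open ≤-Reasoning
  dropTop k j j≤ (x ∷ []) _ (s≤s x≤j ∷ _) | no x≰mk = begin
    a x + 0                                   ≡⟨ +-identityʳ (a x) ⟩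
    a x                                       ≤⟨ a-mono x≤j ⟩
    Σa [] + a j                               ≡⟨ cong (λ l → Σa l + a j) (filter-reject (_≤? m * k) x≰mk) ⟨
    Σa (filter (_≤? m * k) (x ∷ [])) + a j    ∎
    where open ≤-Reasoning
  dropTop k j j≤ (x ∷ y ∷ _) (((x<y , x≁y) ∷ _) ∷ _) (s≤s x≤j ∷ s≤s y≤j ∷ _) | no x≰mk =
    contradiction (sameBin-block m k mk<x (≤-trans x≤j j≤) (<-trans mk<x x<y) (≤-trans y≤j j≤)) x≁y
    where
    mk<x : m * k < x
    mk<x = ≰⇒> x≰mk

  blockBound : ∀ k j B → j ≤ m * suc k → Bounded (suc (m * k)) B → Bounded (suc j) (B + a j)
  blockBound k j B j≤ bounded _ (ls , apart , below , refl) =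
    ≤-trans (dropTop k j j≤ ls apart below) (+-monoˡ-≤ (a j) (bounded _ lowDecomp))
    where
    lowDecomp : LegalDecomp m a (suc (m * k)) (Σa (filter (_≤? m * k) ls))
    lowDecomp = filter (_≤? m * k) ls
              , AllPairsP.filter⁺ (_≤? m * k) apart
              , All.map s≤s (AllP.all-filter (_≤? m * k) ls)
              , refl

  bin₀Bound : Bounded 1 (a 0)
  bin₀Bound _ ([] , _ , _ , refl) = z≤n
  bin₀Bound _ (_ ∷ [] , _ , s≤s z≤n ∷ [] , refl) = ≤-reflexive (+-identityʳ (a 0))
  bin₀Bound _ (_ ∷ _ ∷ _ , ((() , _) ∷ _) ∷ _ , s≤s z≤n ∷ s≤s z≤n ∷ _ , _)

  topSumBound : ∀ k → Bounded (suc (m * k)) (M k)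
  topSumBound zero = subst (λ p → Bounded (suc p) (a 0)) (sym (*-zeroʳ m)) bin₀Bound
  topSumBound (suc k) = blockBound k (m * suc k) (M k) ≤-refl (topSumBound k)

  appendAbove : ∀ k j {z} → m * k < j → a j ≤ z → LegalDecomp m a (suc (m * k)) (z ∸ a j) →
                LegalDecomp m a (suc j) z
  appendAbove k j {z} mk<j aⱼ≤z (ls , apart , below , sum≡) =
    ls ++ j ∷ [] ,
    AllPairsP.++⁺ apart ([] ∷ []) (All.map apartFromJ below) ,
    AllP.++⁺ (All.map (λ i<mk+1 → ≤-trans i<mk+1 (s≤s (<⇒≤ mk<j))) below) (≤-refl ∷ []) ,
    sumWithJ
    where
    apartFromJ : ∀ {i} → i < suc (m * k) → All (Apart i) (j ∷ [])
    apartFromJ i<mk+1 = (≤-trans i<mk+1 mk<j , apart-across m k (≤-pred i<mk+1) mk<j) ∷ []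
    sumWithJ : Σa (ls ++ j ∷ []) ≡ z
    sumWithJ = begin
      Σa (ls ++ j ∷ [])          ≡⟨ cong sum (map-++ a ls (j ∷ [])) ⟩
      sum (map a ls ++ a j ∷ []) ≡⟨ sum-++ (map a ls) (a j ∷ []) ⟩
      Σa ls + (a j + 0)          ≡⟨ cong₂ _+_ sum≡ (+-identityʳ (a j)) ⟩
      z ∸ a j + a j              ≡⟨ m∸n+n≡m aⱼ≤z ⟩
      z                          ∎
      where open ≡-Reasoning

  extend : ∀ k J B → m * k < J → Complete (suc (m * k)) (M k) → Complete J B → a J ≤ suc B →
           Complete (suc J) (a J + M k)
  extend k J B mk<J lowComplete complete aJ≤B+1 z z≤ with z ≤? B
  ... | yes z≤B = widen (n≤1+n J) (complete z z≤B)
  ... | no z≰B = appendAbove k J mk<J (≤-trans aJ≤B+1 (≰⇒> z≰B))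
                   (lowComplete (z ∸ a J) (m≤n+o⇒m∸n≤o z (a J) z≤))

  lastOfBin : ∀ k → n + suc (m * k) ≡ m * suc k
  lastOfBin k = trans (+-suc n (m * k)) (sym (*-suc m k))

  sweep : ∀ k → Complete (suc (m * k)) (M k) → ∀ d → d ≤ n →
          Complete (suc (d + suc (m * k))) (a (d + suc (m * k)) + M k)
  sweep k lowComplete zero _ =
    extend k (suc (m * k)) (M k) ≤-refl lowComplete lowComplete (next-≤ _ _ (topSumBound k))
  sweep k lowComplete (suc d) d<n =
    extend k (suc J) (a J + M k) mk<J+1 lowComplete (sweep k lowComplete d (<⇒≤ d<n)) gapFree
    where
    J : ℕ
    J = d + suc (m * k)
    mk<J+1 : m * k < suc J
    mk<J+1 = s≤s (≤-trans (n≤1+n (m * k)) (m≤n+m (suc (m * k)) d))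
    J≤ : J ≤ m * suc k
    J≤ = ≤-trans (+-monoˡ-≤ (suc (m * k)) (<⇒≤ d<n)) (≤-reflexive (lastOfBin k))
    gapFree : a (suc J) ≤ suc (a J + M k)
    gapFree = subst (λ t → a (suc J) ≤ suc t) (+-comm (M k) (a J))
                (next-≤ (suc J) _ (blockBound k J (M k) J≤ (topSumBound k)))

  bin₀Complete : Complete 1 (a 0)
  bin₀Complete zero _ = emptyDecomp
  bin₀Complete (suc zero) _ = subst (LegalDecomp m a 1) a₀≡1 (singletonDecomp 0 ≤-refl)
  bin₀Complete (suc (suc z)) z+2≤a₀ = contradiction (subst (suc (suc z) ≤_) a₀≡1 z+2≤a₀) λ { (s≤s ()) }

  -- Every z ≤ M_k is a legal sum of a_0..a_{mk}: the sweep through b_{k+1}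
  -- ends at J = m(k+1) with the range [0, a_{m(k+1)} + M_k] = [0, M_{k+1}].
  topSumComplete : ∀ k → Complete (suc (m * k)) (M k)
  topSumComplete zero = subst (λ p → Complete (suc p) (a 0)) (sym (*-zeroʳ m)) bin₀Complete
  topSumComplete (suc k) =
    subst₂ Complete (cong suc (lastOfBin k)) lastBound (sweep k (topSumComplete k) n ≤-refl)
    where
    lastBound : a (n + suc (m * k)) + M k ≡ M (suc k)
    lastBound = trans (cong (λ i → a i + M k) (lastOfBin k)) (+-comm (a (m * suc k)) (M k))

  a-afterBin : ∀ k → a (suc (m * k)) ≡ suc (M k)
  a-afterBin k = ≤-antisym (next-≤ _ _ (topSumBound k)) (next-> _ _ (topSumComplete k))

lemma2p2 : (m k : ℕ) → 1 ≤ m → 1 ≤ k → (a : ℕ → ℕ) → IsMGonal m a →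
    a (m * k + 1) ≡ a (m * k) + a (m * (k ∸ 1) + 1)
lemma2p2 zero _ () _ _ _
lemma2p2 (suc n) zero _ () _ _
lemma2p2 (suc n) (suc k) _ _ a isM = begin
  a (m * suc k + 1)               ≡⟨ cong a (+-comm (m * suc k) 1) ⟩
  a (suc (m * suc k))             ≡⟨ a-afterBin (suc k) ⟩
  suc (M k + a (m * suc k))       ≡⟨ cong suc (+-comm (M k) (a (m * suc k))) ⟩
  suc (a (m * suc k) + M k)       ≡⟨ +-suc (a (m * suc k)) (M k) ⟨
  a (m * suc k) + suc (M k)       ≡⟨ cong (a (m * suc k) +_) (a-afterBin k) ⟨
  a (m * suc k) + a (suc (m * k)) ≡⟨ cong (λ i → a (m * suc k) + a i) (+-comm 1 (m * k)) ⟩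
  a (m * suc k) + a (m * k + 1)   ∎
  where
  open MGonal n a isM
  open ≡-Reasoning
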